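{- If $n\geqslant 2$ is an even integer, then there is an antichain of size $\dfrac{n!}{2^{n/2}}$ in the Bruhat order of $\mathcal{A}(n,2)$.
   Context: $\mathcal{A}(n,k)$ denotes the class of all $n\times n$ matrices with entries in $\{0,1\}$ in which every row and every column sums to $k$. For an $m\times n$ $(0,1)$-matrix $A=[a_{ij}]$ let $\sigma_{ij}(A)=\sum_{k=1}^{i}\sum_{\ell=1}^{j}a_{k\ell}$. For $A,C$ in the same class, $A\preceq_B C$ (Bruhat order) iff $\sigma_{ij}(A)\geqslant\sigma_{ij}(C)$ for all $i,j$. An antichain is a set of pairwise incomparable elements. -}

module Defs where

open import Data.Nat using (ℕ; zero; suc; _+_; _≥_)
open import Data.Fin using (Fin; zero; suc)
open import Data.Sum using (_⊎_)
open import Data.Product using (_×_)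
open import Relation.Binary.PropositionalEquality using (_≡_; _≢_)
open import Relation.Nullary using (¬_)

sumFin : (m : ℕ) → (Fin m → ℕ) → ℕ
sumFin zero    f = 0
sumFin (suc m) f = f zero + sumFin m (λ i → f (suc i))

sumFirst : (m : ℕ) → ℕ → (Fin m → ℕ) → ℕ
sumFirst zero    t       f = 0
sumFirst (suc m) zero    f = 0
sumFirst (suc m) (suc t) f = f zero + sumFirst m t (λ i → f (suc i))

Matrix : ℕ → ℕ → Set
Matrix m n = Fin m → Fin n → ℕ

Is01 : ∀ {m n} → Matrix m n → Set
Is01 A = ∀ i j → (A i j ≡ 0) ⊎ (A i j ≡ 1)

InA : (n k : ℕ) → Matrix n n → Set
InA n k A = Is01 A
          × (∀ i → sumFin n (λ j → A i j) ≡ k)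
          × (∀ j → sumFin n (λ i → A i j) ≡ k)

-- σ_ij(A) = Σ_{k ≤ i} Σ_{ℓ ≤ j} a_kℓ  (i, j are 1-based counts, 1 ≤ i ≤ m, 1 ≤ j ≤ n;
-- for i = 0 or j = 0 the value is 0, which is harmless)
σ : ∀ {m n} → Matrix m n → ℕ → ℕ → ℕ
σ {m} {n} A i j = sumFirst m i (λ k → sumFirst n j (λ ℓ → A k ℓ))

_⪯B_ : ∀ {m n} → Matrix m n → Matrix m n → Set
_⪯B_ {m} {n} A C = ∀ (i : Fin m) (j : Fin n) →
  σ A (suc (Data.Fin.toℕ i)) (suc (Data.Fin.toℕ j)) ≥ σ C (suc (Data.Fin.toℕ i)) (suc (Data.Fin.toℕ j))

-- an antichain of size s in the Bruhat order of 𝒜(n,k): a family of s matrices of 𝒜(n,k),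
-- indexed by Fin s, whose members at distinct indices are pairwise incomparable
-- (incomparability forces them to be distinct, as ⪯B is reflexive)
IsAntichainInA : (n k s : ℕ) → (Fin s → Matrix n n) → Set
IsAntichainInA n k s F =
  (∀ a → InA n k (F a)) × (∀ a b → a ≢ b → ¬ (F a ⪯B F b))

-- n! / 2^(n/2) for n = 2m  (exact division: (2m)! = ∏ (2i-1)(2i) is divisible by 2^m)
open import Data.Nat using (_*_; _^_; _/_; _!)
open import Data.Nat.Properties using (m^n≢0)

evenBound : ℕ → ℕ
evenBound m = _/_ ((2 * m) !) (2 ^ m) {{m^n≢0 2 m}}

-- Write n = 2m. A word g of length n over the letters 0, …, m − 1 in which every letter
-- occurs twice yields the matrix whose row r has its two ones in the mirror-image columns
-- g r and n − 1 − g r; it lies in 𝒜(n,2). Every row is symmetric under j ↦ n − 1 − j, so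
-- its prefixes of lengths s and n − s together contain both of its ones, and
-- σ_{t,s} + σ_{t,n−s} = 2t. Hence if two such matrices are comparable in the Bruhat order,
-- the inequalities at (t, s) and (t, n − s) are both equalities. For s = p + 1 ≤ m,
-- σ_{t,s} counts the rows among the first t with g r ≤ p, and these counts determine g, so
-- distinct words give incomparable matrices. A word is determined by its first letter ℓ,
-- the position of the second ℓ among the remaining 2m − 1 places, and the word formed by
-- the other m − 1 letters, so there are ∏_{k ≤ m} k(2k − 1) = (2m)!/2^m of them.

module Submission where

open import Defs
open import Data.Nat using (ℕ; _≥_; _*_)
open import Data.Fin using (Fin)
open import Data.Product using (Σ)

open import Data.Bool.Base using (if_then_else_)
open import Data.Fin using (toℕ; fromℕ<; punchIn; punchOut; remQuot; combine)
  renaming (zero to fzero; suc to fsuc)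
open import Data.Fin.Properties
  using (toℕ-injective; toℕ<n; toℕ-fromℕ<; punchIn-injective; punchInᵢ≢i; punchIn-punchOut;
         combine-remQuot)
  renaming (_≟_ to _≟ᶠ_)
open import Data.Nat using (zero; suc; _+_; _∸_; _^_; _≤_; _<_; z≤n; s≤s; z<s; s≤s⁻¹;
  _≟_; _<?_; _/_; _!)
open import Data.Nat.DivMod using (m*n/n≡m)
open import Data.Nat.Properties
open import Algebra.Properties.CommutativeSemigroup +-commutativeSemigroup
  using (interchange; x∙yz≈y∙xz)
open import Data.Nat.Tactic.RingSolver using (solve-∀)
open import Data.Product using (_×_; _,_; map₂; uncurry)
open import Data.Product.Properties using (,-injective; ×-≡,≡→≡)
open import Data.Sum using (_⊎_; inj₁; inj₂)
open import Data.Unit using (⊤; tt)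
open import Data.Vec.Functional using (Vector; _∷_; insertAt; tail)
open import Function using (_∘_; _⇔_; mk⇔; Equivalence)
open import Function.Properties.Equivalence using () renaming (trans to ⇔-trans)
open import Level using (Level)
open import Relation.Binary.PropositionalEquality
open import Relation.Nullary using (Dec; yes; no; does; ¬_; contradiction)
open import Relation.Nullary.Decidable using (does-⇔)

private
  variable
    α β γ : Level
    A : Set α
    P : Set β
    Q : Set γ

𝟙 : Dec P → ℕ
𝟙 d = if does d then 1 else 0

𝟙-yes : (d : Dec P) → P → 𝟙 d ≡ 1
𝟙-yes (yes _) _  = refl
𝟙-yes (no ¬x) x = contradiction x ¬x

𝟙-no : (d : Dec P) → ¬ P → 𝟙 d ≡ 0
𝟙-no (yes x) ¬x = contradiction x ¬x
𝟙-no (no _)  _  = refl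

𝟙≡1⇒ : (d : Dec P) → 𝟙 d ≡ 1 → P
𝟙≡1⇒ (yes x) _ = x

𝟙-01 : (d : Dec P) → 𝟙 d ≡ 0 ⊎ 𝟙 d ≡ 1
𝟙-01 (yes _) = inj₂ refl
𝟙-01 (no _)  = inj₁ refl

𝟙-⇔ : P ⇔ Q → (d : Dec P) (e : Dec Q) → 𝟙 d ≡ 𝟙 e
𝟙-⇔ P⇔Q d e = cong (λ b → if b then 1 else 0) (does-⇔ P⇔Q d e)

𝟙-complement : Q ⇔ (¬ P) → (d : Dec P) (e : Dec Q) → 𝟙 d + 𝟙 e ≡ 1
𝟙-complement Q⇔¬P (yes x) e = cong suc (𝟙-no e (λ y → Equivalence.to Q⇔¬P y x))
𝟙-complement Q⇔¬P (no ¬x) e = 𝟙-yes e (Equivalence.from Q⇔¬P ¬x)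

-- Thresholds are written a <? suc p rather than a ≤? p because _<?_ reduces on suc/suc,
-- which sumFirst-δ relies on.
𝟙<suc-injective : ∀ {m a b} → a < m → b < m →
  (∀ p → p < m → 𝟙 (a <? suc p) ≡ 𝟙 (b <? suc p)) → a ≡ b
𝟙<suc-injective {a = a} {b} a<m b<m same = ≤-antisym
  (s≤s⁻¹ (𝟙≡1⇒ (a <? suc b) (trans (same b b<m) (𝟙-yes (b <? suc b) (n<1+n b)))))
  (s≤s⁻¹ (𝟙≡1⇒ (b <? suc a) (trans (sym (same a a<m)) (𝟙-yes (a <? suc a) (n<1+n a)))))

≤-+-≡⇒≡ˡ : ∀ {a b c d} → c ≤ a → d ≤ b → a + b ≡ c + d → a ≡ c
≤-+-≡⇒≡ˡ {a} {b} {c} {d} c≤a d≤b a+b≡c+d = ≤-antisym (+-cancelʳ-≤ b a c (begin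
  a + b ≡⟨ a+b≡c+d ⟩
  c + d ≤⟨ +-monoʳ-≤ c d≤b ⟩
  c + b ∎)) c≤a
  where open ≤-Reasoning

≡toℕ⇔≡fromℕ< : ∀ {m k} (k<m : k < m) (a : Fin m) → k ≡ toℕ a ⇔ a ≡ fromℕ< k<m
≡toℕ⇔≡fromℕ< k<m a = mk⇔
  (λ k≡a → toℕ-injective (trans (sym k≡a) (sym (toℕ-fromℕ< k<m))))
  (λ a≡k → sym (trans (cong toℕ a≡k) (toℕ-fromℕ< k<m)))

sumFin-cong : ∀ n {f g : Fin n → ℕ} → (∀ i → f i ≡ g i) → sumFin n f ≡ sumFin n g
sumFin-cong zero    _   = refl
sumFin-cong (suc n) f≗g = cong₂ _+_ (f≗g fzero) (sumFin-cong n (f≗g ∘ fsuc))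

sumFin-zero : ∀ n → sumFin n (λ _ → 0) ≡ 0
sumFin-zero zero    = refl
sumFin-zero (suc n) = sumFin-zero n

sumFin-insertAt : ∀ {n} (f : A → ℕ) (v : Vector A n) i x →
  sumFin (suc n) (f ∘ insertAt v i x) ≡ f x + sumFin n (f ∘ v)
sumFin-insertAt             f v fzero    x = refl
sumFin-insertAt {n = suc n} f v (fsuc i) x = begin
  f (v fzero) + sumFin (suc n) (f ∘ insertAt (tail v) i x)
    ≡⟨ cong (f (v fzero) +_) (sumFin-insertAt f (tail v) i x) ⟩
  f (v fzero) + (f x + sumFin n (f ∘ tail v))
    ≡⟨ x∙yz≈y∙xz (f (v fzero)) (f x) _ ⟩
  f x + (f (v fzero) + sumFin n (f ∘ tail v)) ∎
  where open ≡-Reasoning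

sumFin≡sumFirst : ∀ n (f : Fin n → ℕ) → sumFin n f ≡ sumFirst n n f
sumFin≡sumFirst zero    f = refl
sumFin≡sumFirst (suc n) f = cong (f fzero +_) (sumFin≡sumFirst n (f ∘ fsuc))

sumFirst-cong : ∀ n t {f g : Fin n → ℕ} → (∀ i → f i ≡ g i) → sumFirst n t f ≡ sumFirst n t g
sumFirst-cong zero    t       _   = refl
sumFirst-cong (suc n) zero    _   = refl
sumFirst-cong (suc n) (suc t) f≗g = cong₂ _+_ (f≗g fzero) (sumFirst-cong n t (f≗g ∘ fsuc))

sumFirst-+ : ∀ n t (f g : Fin n → ℕ) →
  sumFirst n t (λ i → f i + g i) ≡ sumFirst n t f + sumFirst n t g
sumFirst-+ zero    t       f g = refl
sumFirst-+ (suc n) zero    f g = refl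
sumFirst-+ (suc n) (suc t) f g =
  trans (cong (f fzero + g fzero +_) (sumFirst-+ n t (f ∘ fsuc) (g ∘ fsuc)))
        (interchange (f fzero) (g fzero) _ _)

sumFirst-zero : ∀ n t → sumFirst n t (λ _ → 0) ≡ 0
sumFirst-zero zero    t       = refl
sumFirst-zero (suc n) zero    = refl
sumFirst-zero (suc n) (suc t) = sumFirst-zero n t

sumFirst-one : ∀ n (f : Fin (suc n) → ℕ) → sumFirst (suc n) 1 f ≡ f fzero
sumFirst-one zero    f = +-identityʳ (f fzero)
sumFirst-one (suc n) f = +-identityʳ (f fzero)

sumFirst-δ : ∀ n t {c} → c < n → sumFirst n t (λ j → 𝟙 (toℕ j ≟ c)) ≡ 𝟙 (c <? t)
sumFirst-δ (suc n) zero    _         = refl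
sumFirst-δ (suc n) (suc t) {zero}  _ = cong suc (sumFirst-zero n t)
sumFirst-δ (suc n) (suc t) {suc c} c<n = sumFirst-δ n t (s≤s⁻¹ c<n)

sumFirst-injective : ∀ n {f g : Fin n → ℕ} →
  (∀ t → t < n → sumFirst n (suc t) f ≡ sumFirst n (suc t) g) → ∀ i → f i ≡ g i
sumFirst-injective (suc n) {f} {g} eq = pointwise
  where
  head : f fzero ≡ g fzero
  head = trans (sym (sumFirst-one n f)) (trans (eq 0 z<s) (sumFirst-one n g))
  tails : ∀ t → t < n → sumFirst n (suc t) (f ∘ fsuc) ≡ sumFirst n (suc t) (g ∘ fsuc)
  tails t t<n = +-cancelˡ-≡ (f fzero) _ _
    (trans (eq (suc t) (s≤s t<n)) (cong (_+ sumFirst n (suc t) (g ∘ fsuc)) (sym head)))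
  pointwise : ∀ i → f i ≡ g i
  pointwise fzero    = head
  pointwise (fsuc i) = sumFirst-injective n tails i

⪯B⇒σ≥ : ∀ {m n} {A C : Matrix m n} → A ⪯B C →
  ∀ {t s} → 0 < t → t ≤ m → 0 < s → s ≤ n → σ C t s ≤ σ A t s
⪯B⇒σ≥ {A = A} {C} A⪯C {suc t} {suc s} _ t<m _ s<n =
  subst₂ (λ t s → σ C (suc t) (suc s) ≤ σ A (suc t) (suc s))
         (toℕ-fromℕ< t<m) (toℕ-fromℕ< s<n) (A⪯C (fromℕ< t<m) (fromℕ< s<n))

insertAt-injective : ∀ {n} (v w : Vector A n) i j {x} → (∀ k → v k ≢ x) → (∀ k → w k ≢ x) →
  (∀ k → insertAt v i x k ≡ insertAt w j x k) → i ≡ j × (∀ k → v k ≡ w k)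
insertAt-injective v w fzero fzero _ _ eq = refl , eq ∘ fsuc
insertAt-injective {n = suc n} v w fzero (fsuc j) _ w∌x eq =
  contradiction (sym (eq fzero)) (w∌x fzero)
insertAt-injective {n = suc n} v w (fsuc i) fzero v∌x _ eq =
  contradiction (eq fzero) (v∌x fzero)
insertAt-injective {n = suc n} v w (fsuc i) (fsuc j) v∌x w∌x eq
  with refl , tails≗ ← insertAt-injective (tail v) (tail w) i j
                         (v∌x ∘ fsuc) (w∌x ∘ fsuc) (eq ∘ fsuc) =
  refl , λ { fzero → eq fzero ; (fsuc k) → tails≗ k }

remQuot-injective : ∀ {n} k {i j : Fin (n * k)} → remQuot {n} k i ≡ remQuot k j → i ≡ j
remQuot-injective {n} k {i} {j} eq =
  trans (sym (combine-remQuot {n} k i))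
        (trans (cong (uncurry combine) eq) (combine-remQuot {n} k j))

mirror : ℕ → ℕ → ℕ
mirror n q = n ∸ suc q

mirror-< : ∀ {n q} → q < n → mirror n q < n
mirror-< {suc n} {q} _ = s≤s (m∸n≤m n q)

mirror-involutive : ∀ {n q} → q < n → mirror n (mirror n q) ≡ q
mirror-involutive {suc n} q<n = m∸[m∸n]≡n (s≤s⁻¹ q<n)

mirror-swap : ∀ {n q j} → q < n → j < n → j ≡ mirror n q ⇔ mirror n j ≡ q
mirror-swap {n} q<n j<n = mk⇔
  (λ j≡q̃ → trans (cong (mirror n) j≡q̃) (mirror-involutive q<n))
  (λ j̃≡q → trans (sym (mirror-involutive j<n)) (cong (mirror n) j̃≡q))

mirror<∸⇔≮ : ∀ {n q s} → q < n → s ≤ n → mirror n q < n ∸ s ⇔ (¬ q < s)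
mirror<∸⇔≮ {n} {q} {s} q<n s≤n = mk⇔
  (λ q̃<n∸s q<s → <⇒≱ q̃<n∸s (∸-monoʳ-≤ n q<s))
  (λ q≮s → ∸-monoʳ-< (s≤s (≮⇒≥ q≮s)) q<n)

row : ℕ → ℕ → ℕ → ℕ
row n q j = 𝟙 (j ≟ q) + 𝟙 (j ≟ mirror n q)

rowPrefix : ℕ → ℕ → ℕ → ℕ
rowPrefix n q s = sumFirst n s (λ j → row n q (toℕ j))

rowPrefix≡ : ∀ {n q} s → q < n → rowPrefix n q s ≡ 𝟙 (q <? s) + 𝟙 (mirror n q <? s)
rowPrefix≡ {n} {q} s q<n = trans (sumFirst-+ n s _ _)
  (cong₂ _+_ (sumFirst-δ n s q<n) (sumFirst-δ n s (mirror-< q<n)))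

rowPrefix-mirror : ∀ {n q s} → q < n → s ≤ n → rowPrefix n q s + rowPrefix n q (n ∸ s) ≡ 2
rowPrefix-mirror {n} {q} {s} q<n s≤n = begin
  rowPrefix n q s + rowPrefix n q (n ∸ s)
    ≡⟨ cong₂ _+_ (rowPrefix≡ s q<n) (rowPrefix≡ (n ∸ s) q<n) ⟩
  (𝟙 (q <? s) + 𝟙 (q̃ <? s)) + (𝟙 (q <? n ∸ s) + 𝟙 (q̃ <? n ∸ s))
    ≡⟨ cong ((𝟙 (q <? s) + 𝟙 (q̃ <? s)) +_) (+-comm (𝟙 (q <? n ∸ s)) _) ⟩
  (𝟙 (q <? s) + 𝟙 (q̃ <? s)) + (𝟙 (q̃ <? n ∸ s) + 𝟙 (q <? n ∸ s))
    ≡⟨ interchange (𝟙 (q <? s)) _ _ _ ⟩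
  (𝟙 (q <? s) + 𝟙 (q̃ <? n ∸ s)) + (𝟙 (q̃ <? s) + 𝟙 (q <? n ∸ s))
    ≡⟨ cong₂ _+_ (𝟙-complement (mirror<∸⇔≮ q<n s≤n) (q <? s) (q̃ <? n ∸ s)) q̃-complement ⟩
  2 ∎
  where
  open ≡-Reasoning
  q̃ = mirror n q
  q̃-complement : 𝟙 (q̃ <? s) + 𝟙 (q <? n ∸ s) ≡ 1
  q̃-complement = subst (λ x → 𝟙 (q̃ <? s) + 𝟙 (x <? n ∸ s) ≡ 1) (mirror-involutive q<n)
    (𝟙-complement (mirror<∸⇔≮ (mirror-< q<n) s≤n) (q̃ <? s) (mirror n q̃ <? n ∸ s))

double : ℕ → ℕ
double zero    = 0
double (suc m) = suc (suc (double m))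

double≡m+m : ∀ m → double m ≡ m + m
double≡m+m zero    = refl
double≡m+m (suc m) = cong suc (trans (cong suc (double≡m+m m)) (sym (+-suc m m)))

double≡2* : ∀ m → double m ≡ 2 * m
double≡2* m = trans (double≡m+m m) (cong (m +_) (sym (+-identityʳ m)))

<⇒<double : ∀ {m q} → q < m → q < double m
<⇒<double {m} q<m = subst (_ <_) (sym (double≡m+m m)) (≤-trans q<m (m≤m+n m m))

m≤mirror : ∀ {m q} → q < m → m ≤ mirror (double m) q
m≤mirror {m} {q} q<m = begin
  m                ≡⟨ m+n∸n≡m m m ⟨
  m + m ∸ m        ≡⟨ cong (_∸ m) (double≡m+m m) ⟨
  double m ∸ m     ≤⟨ ∸-monoʳ-≤ (double m) q<m ⟩
  double m ∸ suc q ∎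
  where open ≤-Reasoning

mirror<m : ∀ {m j} → m ≤ j → j < double m → mirror (double m) j < m
mirror<m {m} {j} m≤j j<2m = begin-strict
  double m ∸ suc j <⟨ ∸-monoʳ-< (s≤s m≤j) j<2m ⟩
  double m ∸ m     ≡⟨ cong (_∸ m) (double≡m+m m) ⟩
  m + m ∸ m        ≡⟨ m+n∸n≡m m m ⟩
  m                ∎
  where open ≤-Reasoning

row-column : ∀ {m j} → j < double m →
  Σ (Fin m) λ q → ∀ (a : Fin m) → row (double m) (toℕ a) j ≡ 𝟙 (a ≟ᶠ q)
row-column {m} {j} j<2m with j <? m
... | yes j<m = fromℕ< j<m , λ a → begin
  𝟙 (j ≟ toℕ a) + 𝟙 (j ≟ mirror (double m) (toℕ a))
    ≡⟨ cong (𝟙 (j ≟ toℕ a) +_) (𝟙-no (j ≟ _) (<⇒≢ (<-≤-trans j<m (m≤mirror (toℕ<n a))))) ⟩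
  𝟙 (j ≟ toℕ a) + 0
    ≡⟨ +-identityʳ _ ⟩
  𝟙 (j ≟ toℕ a)
    ≡⟨ 𝟙-⇔ (≡toℕ⇔≡fromℕ< j<m a) (j ≟ toℕ a) (a ≟ᶠ fromℕ< j<m) ⟩
  𝟙 (a ≟ᶠ fromℕ< j<m) ∎
  where open ≡-Reasoning
... | no j≮m = fromℕ< j̃<m , λ a → begin
  𝟙 (j ≟ toℕ a) + 𝟙 (j ≟ mirror (double m) (toℕ a))
    ≡⟨ cong (_+ 𝟙 (j ≟ mirror (double m) (toℕ a)))
            (𝟙-no (j ≟ toℕ a) (λ j≡a → j≮m (subst (_< m) (sym j≡a) (toℕ<n a)))) ⟩
  𝟙 (j ≟ mirror (double m) (toℕ a))
    ≡⟨ 𝟙-⇔ (⇔-trans (mirror-swap (<⇒<double (toℕ<n a)) j<2m) (≡toℕ⇔≡fromℕ< j̃<m a))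
         (j ≟ mirror (double m) (toℕ a)) (a ≟ᶠ fromℕ< j̃<m) ⟩
  𝟙 (a ≟ᶠ fromℕ< j̃<m) ∎
  where
  open ≡-Reasoning
  j̃<m : mirror (double m) j < m
  j̃<m = mirror<m (≮⇒≥ j≮m) j<2m

Word : ℕ → Set
Word m = Vector (Fin m) (double m)

occurrences : ∀ {m n} → Vector (Fin m) n → Fin m → ℕ
occurrences {n = n} v q = sumFin n (λ k → 𝟙 (v k ≟ᶠ q))

Code : ℕ → Set
Code zero    = ⊤
Code (suc m) = Fin (suc m) × Fin (suc (double m)) × Code m

word : ∀ {m} → Code m → Word m
word {zero}  _           = λ ()
word {suc m} (ℓ , i , c) = ℓ ∷ insertAt (punchIn ℓ ∘ word c) i ℓ

occurrences-punchIn-self : ∀ {m n} (ℓ : Fin (suc m)) (v : Vector (Fin m) n) →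
  occurrences (punchIn ℓ ∘ v) ℓ ≡ 0
occurrences-punchIn-self {n = n} ℓ v =
  trans (sumFin-cong n (λ k → 𝟙-no (punchIn ℓ (v k) ≟ᶠ ℓ) (punchInᵢ≢i ℓ (v k)))) (sumFin-zero n)

occurrences-punchIn : ∀ {m n} {ℓ q : Fin (suc m)} (ℓ≢q : ℓ ≢ q) (v : Vector (Fin m) n) →
  occurrences (punchIn ℓ ∘ v) q ≡ occurrences v (punchOut ℓ≢q)
occurrences-punchIn {n = n} {ℓ} {q} ℓ≢q v = sumFin-cong n λ k →
  𝟙-⇔ (punchIn≡⇔ (v k)) (punchIn ℓ (v k) ≟ᶠ q) (v k ≟ᶠ punchOut ℓ≢q)
  where
  punchIn≡⇔ : ∀ x → punchIn ℓ x ≡ q ⇔ x ≡ punchOut ℓ≢q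
  punchIn≡⇔ x = mk⇔
    (λ ℓ̂x≡q → punchIn-injective ℓ _ _ (trans ℓ̂x≡q (sym (punchIn-punchOut ℓ≢q))))
    (λ x≡q̌ → trans (cong (punchIn ℓ) x≡q̌) (punchIn-punchOut ℓ≢q))

occurrences-word : ∀ {m} (c : Code m) q → occurrences (word c) q ≡ 2
occurrences-word {suc m} (ℓ , i , c) q = begin
  𝟙 (ℓ ≟ᶠ q) + sumFin (suc (double m)) (λ k → 𝟙 (insertAt v i ℓ k ≟ᶠ q))
    ≡⟨ cong (𝟙 (ℓ ≟ᶠ q) +_) (sumFin-insertAt (λ x → 𝟙 (x ≟ᶠ q)) v i ℓ) ⟩
  𝟙 (ℓ ≟ᶠ q) + (𝟙 (ℓ ≟ᶠ q) + occurrences v q)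
    ≡⟨ by-cases (ℓ ≟ᶠ q) ⟩
  2 ∎
  where
  open ≡-Reasoning
  v = punchIn ℓ ∘ word c
  by-cases : (d : Dec (ℓ ≡ q)) → 𝟙 d + (𝟙 d + occurrences v q) ≡ 2
  by-cases (yes refl) = cong (2 +_) (occurrences-punchIn-self ℓ (word c))
  by-cases (no ℓ≢q)   = trans (occurrences-punchIn ℓ≢q (word c)) (occurrences-word c _)

word-injective : ∀ {m} (c c′ : Code m) → (∀ k → word c k ≡ word c′ k) → c ≡ c′
word-injective {zero}  tt tt _ = refl
word-injective {suc m} (ℓ , i , c) (ℓ′ , j , c′) eq
  with refl ← eq fzero
  with refl , punched≗ ← insertAt-injective (punchIn ℓ ∘ word c) (punchIn ℓ ∘ word c′) i j
                           (punchInᵢ≢i ℓ ∘ word c) (punchInᵢ≢i ℓ ∘ word c′) (eq ∘ fsuc) =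
  cong (λ c → ℓ , i , c) (word-injective c c′ (λ k → punchIn-injective ℓ _ _ (punched≗ k)))

codeCount : ℕ → ℕ
codeCount zero    = 1
codeCount (suc m) = suc m * (suc (double m) * codeCount m)

decode : ∀ m → Fin (codeCount m) → Code m
decode zero    _ = tt
decode (suc m) a =
  map₂ (map₂ (decode m) ∘ remQuot (codeCount m)) (remQuot (suc (double m) * codeCount m) a)

decode-injective : ∀ m {a b : Fin (codeCount m)} → decode m a ≡ decode m b → a ≡ b
decode-injective zero    {fzero} {fzero} _ = refl
decode-injective (suc m) eq
  with ℓ≡ , rest≡ ← ,-injective eq
  with i≡ , code≡ ← ,-injective rest≡ =
  remQuot-injective {suc m} _
    (×-≡,≡→≡ (ℓ≡ , remQuot-injective {suc (double m)} (codeCount m)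
                     (×-≡,≡→≡ (i≡ , decode-injective m code≡))))

double!≡codeCount*2^ : ∀ m → double m ! ≡ codeCount m * 2 ^ m
double!≡codeCount*2^ zero    = refl
double!≡codeCount*2^ (suc m) = begin
  (2 + double m) * ((1 + double m) * double m !)
    ≡⟨ cong (λ f → (2 + double m) * ((1 + double m) * f)) (double!≡codeCount*2^ m) ⟩
  (2 + double m) * ((1 + double m) * (codeCount m * 2 ^ m))
    ≡⟨ subst (λ d → (2 + d) * ((1 + d) * (c * x)) ≡ (1 + m) * ((1 + d) * c) * (2 * x))
             (sym (double≡m+m m)) (regroup m c x) ⟩
  (1 + m) * ((1 + double m) * codeCount m) * (2 * 2 ^ m) ∎
  where
  open ≡-Reasoning
  c = codeCount m
  x = 2 ^ m
  regroup : ∀ m c x →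
    (2 + (m + m)) * ((1 + (m + m)) * (c * x)) ≡ (1 + m) * ((1 + (m + m)) * c) * (2 * x)
  regroup = solve-∀

evenBound≡codeCount : ∀ m → evenBound m ≡ codeCount m
evenBound≡codeCount m = begin
  (2 * m) ! / 2 ^ m           ≡⟨ cong (λ n → n ! / 2 ^ m) (sym (double≡2* m)) ⟩
  double m ! / 2 ^ m          ≡⟨ cong (_/ 2 ^ m) (double!≡codeCount*2^ m) ⟩
  codeCount m * 2 ^ m / 2 ^ m ≡⟨ m*n/n≡m (codeCount m) (2 ^ m) ⟩
  codeCount m ∎
  where
  open ≡-Reasoning
  instance _ = m^n≢0 2 m

wordMatrix : ∀ {m} → Word m → Matrix (double m) (double m)
wordMatrix {m} g i j = row (double m) (toℕ (g i)) (toℕ j)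

wordMatrix∈A : ∀ {m} (g : Word m) → (∀ q → occurrences g q ≡ 2) → InA (double m) 2 (wordMatrix g)
wordMatrix∈A {m} g twice = entries01 , rowSums , columnSums
  where
  entries01 : Is01 (wordMatrix g)
  entries01 i j with q , column ← row-column {m} (toℕ<n j)
    rewrite column (g i) = 𝟙-01 (g i ≟ᶠ q)
  rowSums : ∀ i → sumFin (double m) (wordMatrix g i) ≡ 2
  rowSums i = begin
    sumFin (double m) (wordMatrix g i)          ≡⟨ sumFin≡sumFirst (double m) _ ⟩
    rowPrefix (double m) (toℕ (g i)) (double m) ≡⟨ rowPrefix≡ (double m) gi<2m ⟩
    𝟙 (toℕ (g i) <? double m) + 𝟙 (mirror (double m) (toℕ (g i)) <? double m)
      ≡⟨ cong₂ _+_ (𝟙-yes (toℕ (g i) <? double m) gi<2m) (𝟙-yes (_ <? double m) (mirror-< gi<2m)) ⟩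
    2 ∎
    where
    open ≡-Reasoning
    gi<2m = <⇒<double (toℕ<n (g i))
  columnSums : ∀ j → sumFin (double m) (λ i → wordMatrix g i j) ≡ 2
  columnSums j with q , column ← row-column {m} (toℕ<n j) =
    trans (sumFin-cong (double m) (column ∘ g)) (twice q)

σ-wordMatrix-mirror : ∀ {m} (g : Word m) t {s} → s ≤ double m →
  σ (wordMatrix g) t s + σ (wordMatrix g) t (double m ∸ s) ≡ sumFirst (double m) t (λ _ → 2)
σ-wordMatrix-mirror {m} g t s≤2m = trans (sym (sumFirst-+ (double m) t _ _))
  (sumFirst-cong (double m) t (λ r → rowPrefix-mirror (<⇒<double (toℕ<n (g r))) s≤2m))

σ-wordMatrix-suc : ∀ {m} (g : Word m) t {p} → p < m →
  σ (wordMatrix g) t (suc p) ≡ sumFirst (double m) t (λ r → 𝟙 (toℕ (g r) <? suc p))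
σ-wordMatrix-suc {m} g t {p} p<m = sumFirst-cong (double m) t λ r → begin
  rowPrefix (double m) (toℕ (g r)) (suc p)
    ≡⟨ rowPrefix≡ (suc p) (<⇒<double (toℕ<n (g r))) ⟩
  𝟙 (toℕ (g r) <? suc p) + 𝟙 (mirror (double m) (toℕ (g r)) <? suc p)
    ≡⟨ cong (𝟙 (toℕ (g r) <? suc p) +_) (𝟙-no (_ <? suc p)
         (λ g̃r≤p → <⇒≱ p<m (≤-trans (m≤mirror (toℕ<n (g r))) (s≤s⁻¹ g̃r≤p)))) ⟩
  𝟙 (toℕ (g r) <? suc p) + 0
    ≡⟨ +-identityʳ _ ⟩
  𝟙 (toℕ (g r) <? suc p) ∎
  where open ≡-Reasoning

wordMatrix-⪯B⇒σ≡ : ∀ {m} {g h : Word m} → wordMatrix g ⪯B wordMatrix h →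
  ∀ {t p} → 0 < t → t ≤ double m → p < m →
  σ (wordMatrix g) t (suc p) ≡ σ (wordMatrix h) t (suc p)
wordMatrix-⪯B⇒σ≡ {m} {g} {h} g⪯h {t} {p} 0<t t≤2m p<m = ≤-+-≡⇒≡ˡ
  (⪯B⇒σ≥ g⪯h 0<t t≤2m z<s (<⇒<double p<m))
  (⪯B⇒σ≥ g⪯h 0<t t≤2m (<-≤-trans (≤-<-trans z≤n p<m) (m≤mirror p<m)) (m∸n≤m (double m) (suc p)))
  (trans (σ-wordMatrix-mirror g t (<⇒<double p<m)) (sym (σ-wordMatrix-mirror h t (<⇒<double p<m))))

wordMatrix-⪯B⇒≡ : ∀ {m} {g h : Word m} → wordMatrix g ⪯B wordMatrix h → ∀ r → g r ≡ h r
wordMatrix-⪯B⇒≡ {m} {g} {h} g⪯h r =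
  toℕ-injective (𝟙<suc-injective (toℕ<n (g r)) (toℕ<n (h r)) same-thresholds)
  where
  same-thresholds : ∀ p → p < m → 𝟙 (toℕ (g r) <? suc p) ≡ 𝟙 (toℕ (h r) <? suc p)
  same-thresholds p p<m = sumFirst-injective (double m) (λ t t<2m → begin
    sumFirst (double m) (suc t) (λ k → 𝟙 (toℕ (g k) <? suc p)) ≡⟨ σ-wordMatrix-suc g (suc t) p<m ⟨
    σ (wordMatrix g) (suc t) (suc p)                            ≡⟨ wordMatrix-⪯B⇒σ≡ g⪯h z<s t<2m p<m ⟩
    σ (wordMatrix h) (suc t) (suc p)                            ≡⟨ σ-wordMatrix-suc h (suc t) p<m ⟩
    sumFirst (double m) (suc t) (λ k → 𝟙 (toℕ (h k) <? suc p)) ∎) r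
    where open ≡-Reasoning

wordAntichain : ∀ m →
  Σ (Fin (codeCount m) → Matrix (double m) (double m)) (IsAntichainInA (double m) 2 (codeCount m))
wordAntichain m = wordMatrix ∘ word ∘ decode m , inA , incomparable
  where
  inA : ∀ a → InA (double m) 2 (wordMatrix (word (decode m a)))
  inA a = wordMatrix∈A (word (decode m a)) (occurrences-word (decode m a))
  incomparable : ∀ a b → a ≢ b →
    ¬ (wordMatrix (word (decode m a)) ⪯B wordMatrix (word (decode m b)))
  incomparable a b a≢b a⪯b = a≢b (decode-injective m (word-injective _ _ (wordMatrix-⪯B⇒≡ a⪯b)))

theorem4 : (m : ℕ) → 2 * m ≥ 2 →
    Σ (Fin (evenBound m) → Matrix (2 * m) (2 * m))
      (λ F → IsAntichainInA (2 * m) 2 (evenBound m) F)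
theorem4 m _ = subst₂ (λ n s → Σ (Fin s → Matrix n n) (IsAntichainInA n 2 s))
  (double≡2* m) (sym (evenBound≡codeCount m)) (wordAntichain m)
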